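{- A class $\mathcal{C}\subseteq2^\omega$ of computable reals is EX-learnable if and only if the class $\hat{\mathcal{C}}$ is EX-learnable. Likewise, $\mathcal{C}$ is BC-learnable if and only if $\hat{\mathcal{C}}$ is BC-learnable.
   Context: For a string $\sigma$ or real $X$, $\hat\sigma$ or $\hat X$ is obtained by replacing each digit $0$ by $01$ and each digit $1$ by $10$; $\hat{\mathcal{C}}=\{\hat X:X\in\mathcal{C}\}$. Fix an acceptable numbering $(\varphi_e)$ of partial computable $\{0,1\}$-valued functions; $e$ is an index of computable real $Z$ if $\varphi_e=Z$. $Z\upharpoonright n$ is the first $n$ bits of $Z$. A class $\mathcal{C}$ of computable reals is EX-learnable if some computable $\mathcal{L}:2^{<\omega}\to\mathbb{N}$ satisfies: for every $Z\in\mathcal{C}$, $\lim_n\mathcal{L}(Z\upharpoonright n)$ exists and is an index of $Z$; BC-learnable if some computable $\mathcal{L}$ satisfies: for every $Z\in\mathcal{C}$, $\mathcal{L}(Z\upharpoonright n)$ is an index of $Z$ for all sufficiently large $n$. -}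

module Defs where

open import Data.Nat using (ℕ; zero; suc; _+_; _*_; _^_; _≤_; _<_)
open import Data.Bool using (Bool; true; false; not)
open import Data.List using (List; []; _∷_)
open import Data.Product using (Σ; _×_; _,_)
open import Relation.Binary.PropositionalEquality using (_≡_)

-- A concrete model of partial computable functions: μ-recursive codes
-- (untyped: arguments are lists of naturals; arity mismatches just
-- yield some, possibly undefined, partial computable behaviour).

data Code : Set where
  zer  : Code
  succ : Code
  proj : ℕ → Code                 -- i-th argument (0 if out of range)
  comp : Code → List Code → Code
  prec : Code → Code → Code
  mu   : Code → Code

head0 : List ℕ → ℕ
head0 []      = 0
head0 (x ∷ _) = x

nth0 : ℕ → List ℕ → ℕ
nth0 _       []       = 0
nth0 zero    (x ∷ _)  = x
nth0 (suc i) (_ ∷ xs) = nth0 i xs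

data Eval : Code → List ℕ → ℕ → Set
data EvalList : List Code → List ℕ → List ℕ → Set

data Eval where
  ev-zer  : ∀ {xs} → Eval zer xs 0
  ev-succ : ∀ {xs} → Eval succ xs (suc (head0 xs))
  ev-proj : ∀ {i xs} → Eval (proj i) xs (nth0 i xs)
  ev-comp : ∀ {f gs xs ys y} → EvalList gs xs ys → Eval f ys y → Eval (comp f gs) xs y
  ev-prec0 : ∀ {f g xs y} → Eval f xs y → Eval (prec f g) (0 ∷ xs) y
  ev-precS : ∀ {f g n xs y z} → Eval (prec f g) (n ∷ xs) y →
             Eval g (n ∷ y ∷ xs) z → Eval (prec f g) (suc n ∷ xs) z
  ev-mu   : ∀ {f xs n} → Eval f (n ∷ xs) 0 →
            (∀ m → m < n → Σ ℕ (λ k → Eval f (m ∷ xs) (suc k))) →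
            Eval (mu f) xs n

data EvalList where
  evl-[] : ∀ {xs} → EvalList [] xs []
  evl-∷  : ∀ {g gs xs y ys} → Eval g xs y → EvalList gs xs ys → EvalList (g ∷ gs) xs (y ∷ ys)

-- Gödel numbering of codes (injective, with decidable range).

pair : ℕ → ℕ → ℕ
pair a b = 2 ^ a * suc (2 * b)

encode : Code → ℕ
encodeList : List Code → ℕ
encode zer        = 0
encode succ       = pair 0 0
encode (proj i)   = pair 1 i
encode (comp f gs) = pair 2 (pair (encode f) (encodeList gs))
encode (prec f g) = pair 3 (pair (encode f) (encode g))
encode (mu f)     = pair 4 (encode f)
encodeList []       = 0
encodeList (c ∷ cs) = pair (encode c) (encodeList cs)

-- The fixed acceptable numbering (φ_e): φ_e(x) ↓= y.
-- Numbers outside the range of encode index the empty function.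
φ_⟨_⟩↓_ : ℕ → ℕ → ℕ → Set
φ e ⟨ x ⟩↓ y = Σ Code (λ c → (encode c ≡ e) × Eval c (x ∷ []) y)

bit : Bool → ℕ
bit false = 0
bit true  = 1

IsIndex : ℕ → (ℕ → Bool) → Set
IsIndex e Z = ∀ n → φ e ⟨ n ⟩↓ bit (Z n)

_↾_ : (ℕ → Bool) → ℕ → List Bool
Z ↾ zero  = []
Z ↾ suc n = Z 0 ∷ ((λ k → Z (suc k)) ↾ n)

-- bijective coding of binary strings by natural numbers
codeStr : List Bool → ℕ
codeStr []      = 0
codeStr (b ∷ σ) = suc (2 * codeStr σ + bit b)

Computable : (List Bool → ℕ) → Set
Computable L = Σ Code (λ c → ∀ σ → Eval c (codeStr σ ∷ []) (L σ))

-- X̂ : 0 ↦ 01, 1 ↦ 10, i.e. X̂(2n) = X(n), X̂(2n+1) = 1 - X(n)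
hat : (ℕ → Bool) → ℕ → Bool
hat X zero          = X 0
hat X (suc zero)    = not (X 0)
hat X (suc (suc n)) = hat (λ k → X (suc k)) n

Class : Set₁
Class = (ℕ → Bool) → Set

-- Ĉ = { X̂ : X ∈ C }  (equality of reals = pointwise equality)
hatClass : Class → Class
hatClass C Y = Σ (ℕ → Bool) (λ X → C X × (∀ n → Y n ≡ hat X n))

OfComputables : Class → Set
OfComputables C = ∀ Z → C Z → Σ ℕ (λ e → IsIndex e Z)

EXLearnable : Class → Set
EXLearnable C = Σ (List Bool → ℕ) (λ L → Computable L ×
  (∀ Z → C Z → Σ ℕ (λ e → Σ ℕ (λ N →
     (∀ n → N ≤ n → L (Z ↾ n) ≡ e) × IsIndex e Z))))

BCLearnable : Class → Set
BCLearnable C = Σ (List Bool → ℕ) (λ L → Computable L ×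
  (∀ Z → C Z → Σ ℕ (λ N → ∀ n → N ≤ n → IsIndex (L (Z ↾ n)) Z)))

-- Both transfers translate learners uniformly. The even-position bits of X̂ ↾ n form X ↾ ⌈n/2⌉,
-- so a learner for Ĉ can run a learner for C on them and turn each guessed index of X into one of
-- X̂, since X̂(n) = parity(n) xor X(⌊n/2⌋); conversely a learner for C runs a learner for Ĉ on σ̂ and
-- precomposes its guess with n ↦ 2n. Both translations of strings are computable (by recursion
-- along the tail of the bijective binary code) and both translations of indices are computable
-- (a Gödel number of a composite code is a computable function of those of its parts), so
-- convergence to one correct index and eventual correctness of all guesses are both preserved.
module Submission where

open import Defs
open import Data.Product using (Σ; _×_; _,_; proj₁; proj₂)
open import Function.Bundles using (_⇔_; mk⇔)
open import Data.Bool using (Bool; true; false; not; _xor_)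
open import Data.Bool.Properties using (not-involutive)
open import Data.List using (List; []; _∷_; length; drop)
open import Data.Nat using (ℕ; zero; suc; _+_; _*_; _∸_; _^_; _≤_; pred; z≤n; s≤s; ⌊_/2⌋; ⌈_/2⌉)
open import Data.Nat.Properties
open import Data.Nat.GeneralisedArithmetic using (fold; iterate; iterate-is-fold)
open import Relation.Binary.PropositionalEquality

Computes : Code → (List ℕ → ℕ) → Set
Computes c F = ∀ xs → Eval c xs (F xs)

ComputesAll : List Code → (List ℕ → List ℕ) → Set
ComputesAll gs G = ∀ xs → EvalList gs xs (G xs)

Computes-cong : ∀ {c F G} → Computes c F → (∀ xs → F xs ≡ G xs) → Computes c G
Computes-cong {c} comp-F F≗G xs = subst (Eval c xs) (F≗G xs) (comp-F xs)

[]ᶜ : ComputesAll [] (λ _ → [])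
[]ᶜ xs = evl-[]

infixr 5 _∷ᶜ_
_∷ᶜ_ : ∀ {g gs G Gs} → Computes g G → ComputesAll gs Gs →
        ComputesAll (g ∷ gs) (λ xs → G xs ∷ Gs xs)
(comp-G ∷ᶜ comp-Gs) xs = evl-∷ (comp-G xs) (comp-Gs xs)

zer-computes : Computes zer (λ _ → 0)
zer-computes xs = ev-zer

succ-computes : Computes succ (λ xs → suc (head0 xs))
succ-computes xs = ev-succ

proj-computes : ∀ i → Computes (proj i) (nth0 i)
proj-computes i xs = ev-proj

comp-computes : ∀ {f gs F Gs} → Computes f F → ComputesAll gs Gs → Computes (comp f gs) (λ xs → F (Gs xs))
comp-computes comp-F comp-Gs xs = ev-comp (comp-Gs xs) (comp-F _)

primRec : (List ℕ → ℕ) → (List ℕ → ℕ) → ℕ → List ℕ → ℕ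
primRec F G zero    xs = F xs
primRec F G (suc n) xs = G (n ∷ primRec F G n xs ∷ xs)

prec-evaluates : ∀ {f g F G} → Computes f F → Computes g G →
                 ∀ n xs → Eval (prec f g) (n ∷ xs) (primRec F G n xs)
prec-evaluates comp-F comp-G zero    xs = ev-prec0 (comp-F xs)
prec-evaluates comp-F comp-G (suc n) xs = ev-precS (prec-evaluates comp-F comp-G n xs) (comp-G _)

prec-computes : ∀ {f g h hs F G H Hs} →
                Computes f F → Computes g G → Computes h H → ComputesAll hs Hs →
                Computes (comp (prec f g) (h ∷ hs)) (λ xs → primRec F G (H xs) (Hs xs))
prec-computes comp-F comp-G comp-H comp-Hs xs =
  ev-comp (evl-∷ (comp-H xs) (comp-Hs xs)) (prec-evaluates comp-F comp-G _ _)

constᶜ : ℕ → Code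
constᶜ zero    = zer
constᶜ (suc n) = comp succ (constᶜ n ∷ [])

constᶜ-computes : ∀ n → Computes (constᶜ n) (λ _ → n)
constᶜ-computes zero    = zer-computes
constᶜ-computes (suc n) = comp-computes succ-computes (constᶜ-computes n ∷ᶜ []ᶜ)

addᶜ : Code
addᶜ = comp (prec (proj 0) (comp succ (proj 1 ∷ []))) (proj 0 ∷ proj 1 ∷ [])

addᶜ-computes : Computes addᶜ (λ xs → nth0 0 xs + nth0 1 xs)
addᶜ-computes = Computes-cong
  (prec-computes (proj-computes 0) (comp-computes succ-computes (proj-computes 1 ∷ᶜ []ᶜ))
                 (proj-computes 0) (proj-computes 1 ∷ᶜ []ᶜ))
  (λ xs → primRec≡+ (nth0 0 xs) (nth0 1 xs))
  where
  primRec≡+ : ∀ m n → primRec (nth0 0) (λ zs → suc (nth0 1 zs)) m (n ∷ []) ≡ m + n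
  primRec≡+ zero    n = refl
  primRec≡+ (suc m) n = cong suc (primRec≡+ m n)

mulᶜ : Code
mulᶜ = comp (prec zer (comp addᶜ (proj 1 ∷ proj 2 ∷ []))) (proj 0 ∷ proj 1 ∷ [])

mulᶜ-computes : Computes mulᶜ (λ xs → nth0 0 xs * nth0 1 xs)
mulᶜ-computes = Computes-cong
  (prec-computes zer-computes (comp-computes addᶜ-computes (proj-computes 1 ∷ᶜ proj-computes 2 ∷ᶜ []ᶜ))
                 (proj-computes 0) (proj-computes 1 ∷ᶜ []ᶜ))
  (λ xs → primRec≡* (nth0 0 xs) (nth0 1 xs))
  where
  primRec≡* : ∀ m n → primRec (λ _ → 0) (λ zs → nth0 1 zs + nth0 2 zs) m (n ∷ []) ≡ m * n
  primRec≡* zero    n = refl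
  primRec≡* (suc m) n = trans (cong (_+ n) (primRec≡* m n)) (+-comm (m * n) n)

pow2ᶜ : Code
pow2ᶜ = comp (prec (constᶜ 1) (comp mulᶜ (constᶜ 2 ∷ proj 1 ∷ []))) (proj 0 ∷ [])

pow2ᶜ-computes : Computes pow2ᶜ (λ xs → 2 ^ nth0 0 xs)
pow2ᶜ-computes = Computes-cong
  (prec-computes (constᶜ-computes 1)
                 (comp-computes mulᶜ-computes (constᶜ-computes 2 ∷ᶜ proj-computes 1 ∷ᶜ []ᶜ))
                 (proj-computes 0) []ᶜ)
  (λ xs → primRec≡2^ (nth0 0 xs))
  where
  primRec≡2^ : ∀ n → primRec (λ _ → 1) (λ zs → 2 * nth0 1 zs) n [] ≡ 2 ^ n
  primRec≡2^ zero    = refl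
  primRec≡2^ (suc n) = cong (2 *_) (primRec≡2^ n)

predᶜ : Code
predᶜ = comp (prec zer (proj 0)) (proj 0 ∷ [])

predᶜ-computes : Computes predᶜ (λ xs → pred (nth0 0 xs))
predᶜ-computes = Computes-cong (prec-computes zer-computes (proj-computes 0) (proj-computes 0) []ᶜ) primRec≡pred
  where
  primRec≡pred : ∀ xs → primRec (λ _ → 0) (nth0 0) (nth0 0 xs) [] ≡ pred (nth0 0 xs)
  primRec≡pred xs with nth0 0 xs
  ... | zero  = refl
  ... | suc n = refl

monusᶜ : Code
monusᶜ = comp (prec (proj 0) (comp predᶜ (proj 1 ∷ []))) (proj 1 ∷ proj 0 ∷ [])

monusᶜ-computes : Computes monusᶜ (λ xs → nth0 0 xs ∸ nth0 1 xs)
monusᶜ-computes = Computes-cong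
  (prec-computes (proj-computes 0) (comp-computes predᶜ-computes (proj-computes 1 ∷ᶜ []ᶜ))
                 (proj-computes 1) (proj-computes 0 ∷ᶜ []ᶜ))
  (λ xs → primRec≡∸ (nth0 1 xs) (nth0 0 xs))
  where
  primRec≡∸ : ∀ n m → primRec (nth0 0) (λ zs → pred (nth0 1 zs)) n (m ∷ []) ≡ m ∸ n
  primRec≡∸ zero    m = refl
  primRec≡∸ (suc n) m = trans (cong pred (primRec≡∸ n m)) (pred[m∸n]≡m∸[1+n] m n)

ifZero : ℕ → ℕ → ℕ → ℕ
ifZero zero    a b = a
ifZero (suc _) a b = b

ifZeroᶜ : Code
ifZeroᶜ = comp (prec (proj 0) (proj 3)) (proj 0 ∷ proj 1 ∷ proj 2 ∷ [])

ifZeroᶜ-computes : Computes ifZeroᶜ (λ xs → ifZero (nth0 0 xs) (nth0 1 xs) (nth0 2 xs))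
ifZeroᶜ-computes = Computes-cong
  (prec-computes (proj-computes 0) (proj-computes 3)
                 (proj-computes 0) (proj-computes 1 ∷ᶜ proj-computes 2 ∷ᶜ []ᶜ))
  primRec≡ifZero
  where
  primRec≡ifZero : ∀ xs → primRec (nth0 0) (nth0 3) (nth0 0 xs) (nth0 1 xs ∷ nth0 2 xs ∷ [])
                          ≡ ifZero (nth0 0 xs) (nth0 1 xs) (nth0 2 xs)
  primRec≡ifZero xs with nth0 0 xs
  ... | zero  = refl
  ... | suc n = refl

notᶜ : Code
notᶜ = comp ifZeroᶜ (proj 0 ∷ constᶜ 1 ∷ zer ∷ [])

notᶜ-computes : Computes notᶜ (λ xs → ifZero (nth0 0 xs) 1 0)
notᶜ-computes =
  comp-computes ifZeroᶜ-computes (proj-computes 0 ∷ᶜ constᶜ-computes 1 ∷ᶜ zer-computes ∷ᶜ []ᶜ)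

bit-not : ∀ b → ifZero (bit b) 1 0 ≡ bit (not b)
bit-not false = refl
bit-not true  = refl

parity : ℕ → Bool
parity zero    = false
parity (suc n) = not (parity n)

⌊suc-n/2⌋≡⌊n/2⌋+parity : ∀ n → ⌊ suc n /2⌋ ≡ ⌊ n /2⌋ + bit (parity n)
⌊suc-n/2⌋≡⌊n/2⌋+parity zero          = refl
⌊suc-n/2⌋≡⌊n/2⌋+parity (suc zero)    = refl
⌊suc-n/2⌋≡⌊n/2⌋+parity (suc (suc n)) rewrite not-involutive (parity n) =
  cong suc (⌊suc-n/2⌋≡⌊n/2⌋+parity n)

parity-bit+bit : ∀ a b → bit (parity (bit a + bit b)) ≡ bit (a xor b)
parity-bit+bit false false = refl
parity-bit+bit false true  = refl
parity-bit+bit true  false = refl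
parity-bit+bit true  true  = refl

-- Opaque because these codes occur in the Gödel numbers produced by the index maps below;
-- unfolding them there would make the type checker expand those numbers into unary numerals.
opaque
  parityᶜ : Code
  parityᶜ = comp (prec zer (comp notᶜ (proj 1 ∷ []))) (proj 0 ∷ [])

  parityᶜ-computes : Computes parityᶜ (λ xs → bit (parity (nth0 0 xs)))
  parityᶜ-computes = Computes-cong
    (prec-computes zer-computes (comp-computes notᶜ-computes (proj-computes 1 ∷ᶜ []ᶜ)) (proj-computes 0) []ᶜ)
    (λ xs → primRec≡parity (nth0 0 xs))
    where
    primRec≡parity : ∀ n → primRec (λ _ → 0) (λ zs → ifZero (nth0 1 zs) 1 0) n [] ≡ bit (parity n)
    primRec≡parity zero    = refl
    primRec≡parity (suc n) = trans (cong (λ p → ifZero p 1 0) (primRec≡parity n)) (bit-not (parity n))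

  halfᶜ : Code
  halfᶜ = comp (prec zer (comp addᶜ (proj 1 ∷ comp parityᶜ (proj 0 ∷ []) ∷ []))) (proj 0 ∷ [])

  halfᶜ-computes : Computes halfᶜ (λ xs → ⌊ nth0 0 xs /2⌋)
  halfᶜ-computes = Computes-cong
    (prec-computes zer-computes
      (comp-computes addᶜ-computes
        (proj-computes 1 ∷ᶜ comp-computes parityᶜ-computes (proj-computes 0 ∷ᶜ []ᶜ) ∷ᶜ []ᶜ))
      (proj-computes 0) []ᶜ)
    (λ xs → primRec≡⌊/2⌋ (nth0 0 xs))
    where
    primRec≡⌊/2⌋ : ∀ n → primRec (λ _ → 0) (λ zs → nth0 1 zs + bit (parity (nth0 0 zs))) n [] ≡ ⌊ n /2⌋
    primRec≡⌊/2⌋ zero    = refl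
    primRec≡⌊/2⌋ (suc n) =
      trans (cong (_+ bit (parity n)) (primRec≡⌊/2⌋ n)) (sym (⌊suc-n/2⌋≡⌊n/2⌋+parity n))

  xorᶜ : Code
  xorᶜ = comp parityᶜ (addᶜ ∷ [])

  xorᶜ-computes : Computes xorᶜ (λ xs → bit (parity (nth0 0 xs + nth0 1 xs)))
  xorᶜ-computes = comp-computes parityᶜ-computes (addᶜ-computes ∷ᶜ []ᶜ)

  doubleᶜ : Code
  doubleᶜ = comp addᶜ (proj 0 ∷ proj 0 ∷ [])

  doubleᶜ-computes : Computes doubleᶜ (λ xs → nth0 0 xs + nth0 0 xs)
  doubleᶜ-computes = comp-computes addᶜ-computes (proj-computes 0 ∷ᶜ proj-computes 0 ∷ᶜ []ᶜ)

pairᶜ : Code → Code → Code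
pairᶜ a b = comp mulᶜ (comp pow2ᶜ (a ∷ []) ∷ comp succ (comp mulᶜ (constᶜ 2 ∷ b ∷ []) ∷ []) ∷ [])

pairᶜ-computes : ∀ {a b A B} → Computes a A → Computes b B →
                 Computes (pairᶜ a b) (λ xs → pair (A xs) (B xs))
pairᶜ-computes comp-A comp-B = comp-computes mulᶜ-computes
  (comp-computes pow2ᶜ-computes (comp-A ∷ᶜ []ᶜ) ∷ᶜ
   comp-computes succ-computes
     (comp-computes mulᶜ-computes (constᶜ-computes 2 ∷ᶜ comp-B ∷ᶜ []ᶜ) ∷ᶜ []ᶜ) ∷ᶜ []ᶜ)

-- A code for the constant encode c whose size is linear in that of c, unlike constᶜ (encode c).
quoteᶜ : Code → Code
quoteListᶜ : List Code → Code
quoteᶜ zer         = zer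
quoteᶜ succ        = pairᶜ zer zer
quoteᶜ (proj i)    = pairᶜ (constᶜ 1) (constᶜ i)
quoteᶜ (comp f gs) = pairᶜ (constᶜ 2) (pairᶜ (quoteᶜ f) (quoteListᶜ gs))
quoteᶜ (prec f g)  = pairᶜ (constᶜ 3) (pairᶜ (quoteᶜ f) (quoteᶜ g))
quoteᶜ (mu f)      = pairᶜ (constᶜ 4) (quoteᶜ f)
quoteListᶜ []       = zer
quoteListᶜ (c ∷ cs) = pairᶜ (quoteᶜ c) (quoteListᶜ cs)

quoteᶜ-computes : ∀ c → Computes (quoteᶜ c) (λ _ → encode c)
quoteListᶜ-computes : ∀ cs → Computes (quoteListᶜ cs) (λ _ → encodeList cs)
quoteᶜ-computes zer         = zer-computes
quoteᶜ-computes succ        = pairᶜ-computes zer-computes zer-computes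
quoteᶜ-computes (proj i)    = pairᶜ-computes (constᶜ-computes 1) (constᶜ-computes i)
quoteᶜ-computes (comp f gs) =
  pairᶜ-computes (constᶜ-computes 2) (pairᶜ-computes (quoteᶜ-computes f) (quoteListᶜ-computes gs))
quoteᶜ-computes (prec f g)  =
  pairᶜ-computes (constᶜ-computes 3) (pairᶜ-computes (quoteᶜ-computes f) (quoteᶜ-computes g))
quoteᶜ-computes (mu f)      = pairᶜ-computes (constᶜ-computes 4) (quoteᶜ-computes f)
quoteListᶜ-computes []       = zer-computes
quoteListᶜ-computes (c ∷ cs) = pairᶜ-computes (quoteᶜ-computes c) (quoteListᶜ-computes cs)

codeHead : ℕ → Bool
codeHead y = parity (pred y)

codeTail : ℕ → ℕ
codeTail y = ⌊ pred y /2⌋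

parity-double+ : ∀ m k → parity (m + m + k) ≡ parity k
parity-double+ zero    k = refl
parity-double+ (suc m) k rewrite +-suc m m | not-involutive (parity (m + m + k)) = parity-double+ m k

codeHead-∷ : ∀ b σ → codeHead (codeStr (b ∷ σ)) ≡ b
codeHead-∷ b σ rewrite +-identityʳ (codeStr σ) | parity-double+ (codeStr σ) (bit b) with b
... | false = refl
... | true  = refl

codeTail-∷ : ∀ b σ → codeTail (codeStr (b ∷ σ)) ≡ codeStr σ
codeTail-∷ b σ rewrite +-identityʳ (codeStr σ) with b
... | false = trans (cong ⌊_/2⌋ (+-identityʳ (codeStr σ + codeStr σ))) (sym (n≡⌊n+n/2⌋ (codeStr σ)))
... | true  = trans (cong ⌊_/2⌋ (+-comm (codeStr σ + codeStr σ) 1)) (sym (n≡⌈n+n/2⌉ (codeStr σ)))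

length≤codeStr : ∀ σ → length σ ≤ codeStr σ
length≤codeStr []      = z≤n
length≤codeStr (b ∷ σ) =
  s≤s (≤-trans (length≤codeStr σ) (≤-trans (m≤m+n (codeStr σ) _) (m≤m+n _ (bit b))))

headᶜ : Code
headᶜ = comp parityᶜ (predᶜ ∷ [])

headᶜ-computes : Computes headᶜ (λ xs → bit (codeHead (nth0 0 xs)))
headᶜ-computes = comp-computes parityᶜ-computes (predᶜ-computes ∷ᶜ []ᶜ)

tailᶜ : Code
tailᶜ = comp halfᶜ (predᶜ ∷ [])

tailᶜ-computes : Computes tailᶜ (λ xs → codeTail (nth0 0 xs))
tailᶜ-computes = comp-computes halfᶜ-computes (predᶜ-computes ∷ᶜ []ᶜ)

consᶜ : Code → Code → Code
consᶜ b c = comp succ (comp addᶜ (comp mulᶜ (constᶜ 2 ∷ c ∷ []) ∷ b ∷ []) ∷ [])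

consᶜ-computes : ∀ {b c B C} → Computes b B → Computes c C →
                 Computes (consᶜ b c) (λ xs → suc (2 * C xs + B xs))
consᶜ-computes comp-B comp-C = comp-computes succ-computes
  (comp-computes addᶜ-computes
    (comp-computes mulᶜ-computes (constᶜ-computes 2 ∷ᶜ comp-C ∷ᶜ []ᶜ) ∷ᶜ comp-B ∷ᶜ []ᶜ) ∷ᶜ []ᶜ)

module StringRecursion
  (tl : List Bool → List Bool) (tl-[] : tl [] ≡ [])
  (tl-shrinks : ∀ b σ → length (tl (b ∷ σ)) ≤ length σ)
  (t : ℕ → ℕ) (tᶜ : Code) (tᶜ-computes : Computes tᶜ (λ xs → t (nth0 0 xs)))
  (t-codeStr : ∀ σ → t (codeStr σ) ≡ codeStr (tl σ))
  where

  iterate-tl-[] : ∀ k σ → length σ ≤ k → iterate tl σ k ≡ []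
  iterate-tl-[] zero    []      _       = refl
  iterate-tl-[] (suc k) []      _       rewrite tl-[] = iterate-tl-[] k [] z≤n
  iterate-tl-[] (suc k) (b ∷ σ) (s≤s l) = iterate-tl-[] k (tl (b ∷ σ)) (≤-trans (tl-shrinks b σ) l)

  fold-t-codeStr : ∀ σ k → fold (codeStr σ) t k ≡ codeStr (fold σ tl k)
  fold-t-codeStr σ zero    = refl
  fold-t-codeStr σ (suc k) = trans (cong t (fold-t-codeStr σ k)) (t-codeStr (fold σ tl k))

  foldᶜ : Code
  foldᶜ = comp (prec (proj 0) (comp tᶜ (proj 1 ∷ []))) (proj 0 ∷ proj 1 ∷ [])

  foldᶜ-computes : Computes foldᶜ (λ xs → fold (nth0 1 xs) t (nth0 0 xs))
  foldᶜ-computes = Computes-cong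
    (prec-computes (proj-computes 0) (comp-computes tᶜ-computes (proj-computes 1 ∷ᶜ []ᶜ))
                   (proj-computes 0) (proj-computes 1 ∷ᶜ []ᶜ))
    (λ xs → primRec≡fold (nth0 0 xs) (nth0 1 xs))
    where
    primRec≡fold : ∀ k y → primRec (nth0 0) (λ zs → t (nth0 1 zs)) k (y ∷ []) ≡ fold y t k
    primRec≡fold zero    y = refl
    primRec≡fold (suc k) y = cong t (primRec≡fold k y)

  module _
    (f : List Bool → List Bool) (f-[] : f [] ≡ [])
    (G : ℕ → ℕ → ℕ) (gᶜ : Code) (gᶜ-computes : Computes gᶜ (λ xs → G (nth0 0 xs) (nth0 1 xs)))
    (f-∷ : ∀ b σ → codeStr (f (b ∷ σ)) ≡ G (codeStr (b ∷ σ)) (codeStr (f (tl (b ∷ σ)))))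
    where

    -- f is evaluated inside out: on input y = codeStr σ, round j of the loop yields f of the
    -- (y ∸ j)-th tail of σ, which is [] at round 0 because length σ ≤ y.
    suffix : List ℕ → ℕ
    suffix zs = fold (nth0 2 zs) t (nth0 2 zs ∸ suc (nth0 0 zs))

    loopStep : List ℕ → ℕ
    loopStep zs = ifZero (suffix zs) 0 (G (suffix zs) (nth0 1 zs))

    suffixᶜ : Code
    suffixᶜ = comp foldᶜ (comp monusᶜ (proj 2 ∷ comp succ (proj 0 ∷ []) ∷ []) ∷ proj 2 ∷ [])

    suffixᶜ-computes : Computes suffixᶜ suffix
    suffixᶜ-computes = comp-computes foldᶜ-computes
      (comp-computes monusᶜ-computes
        (proj-computes 2 ∷ᶜ comp-computes succ-computes (proj-computes 0 ∷ᶜ []ᶜ) ∷ᶜ []ᶜ)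
       ∷ᶜ proj-computes 2 ∷ᶜ []ᶜ)

    loopᶜ : Code
    loopᶜ = comp (prec zer (comp ifZeroᶜ (suffixᶜ ∷ zer ∷ comp gᶜ (suffixᶜ ∷ proj 1 ∷ []) ∷ [])))
                 (proj 0 ∷ proj 0 ∷ [])

    loopᶜ-computes : Computes loopᶜ (λ xs → primRec (λ _ → 0) loopStep (nth0 0 xs) (nth0 0 xs ∷ []))
    loopᶜ-computes = prec-computes zer-computes
      (comp-computes ifZeroᶜ-computes
        (suffixᶜ-computes ∷ᶜ zer-computes ∷ᶜ
         comp-computes gᶜ-computes (suffixᶜ-computes ∷ᶜ proj-computes 1 ∷ᶜ []ᶜ) ∷ᶜ []ᶜ))
      (proj-computes 0) (proj-computes 0 ∷ᶜ []ᶜ)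

    unfold-f : ∀ ρ → ifZero (codeStr ρ) 0 (G (codeStr ρ) (codeStr (f (tl ρ)))) ≡ codeStr (f ρ)
    unfold-f []      = sym (cong codeStr f-[])
    unfold-f (b ∷ ρ) = sym (f-∷ b ρ)

    loop-invariant : ∀ σ j k → k + j ≡ codeStr σ →
                     primRec (λ _ → 0) loopStep j (codeStr σ ∷ []) ≡ codeStr (f (fold σ tl k))
    loop-invariant σ zero k k+0≡y = sym (cong codeStr (trans (cong f fold≡[]) f-[]))
      where
      fold≡[] : fold σ tl k ≡ []
      fold≡[] = trans (iterate-is-fold σ tl k)
        (iterate-tl-[] k σ (subst (length σ ≤_) (trans (sym k+0≡y) (+-identityʳ k)) (length≤codeStr σ)))
    loop-invariant σ (suc j) k k+1+j≡y = begin
        ifZero (suffix zs) 0 (G (suffix zs) (primRec (λ _ → 0) loopStep j (y ∷ [])))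
      ≡⟨ cong₂ (λ z r → ifZero z 0 (G z r)) suffix≡ρ
               (loop-invariant σ j (suc k) (trans (sym (+-suc k j)) k+1+j≡y)) ⟩
        ifZero (codeStr ρ) 0 (G (codeStr ρ) (codeStr (f (tl ρ))))
      ≡⟨ unfold-f ρ ⟩
        codeStr (f ρ) ∎
      where
      open ≡-Reasoning
      y  = codeStr σ
      ρ  = fold σ tl k
      zs = j ∷ primRec (λ _ → 0) loopStep j (y ∷ []) ∷ y ∷ []
      suffix≡ρ : suffix zs ≡ codeStr ρ
      suffix≡ρ = trans (cong (fold y t) (trans (cong (_∸ suc j) (sym k+1+j≡y)) (m+n∸n≡m k (suc j))))
                       (fold-t-codeStr σ k)

    computable : Computable (λ σ → codeStr (f σ))
    computable = loopᶜ , λ σ → subst (Eval loopᶜ (codeStr σ ∷ [])) (loop-invariant σ (codeStr σ) 0 refl)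
                                     (loopᶜ-computes (codeStr σ ∷ []))

drop1-codeStr : ∀ σ → codeTail (codeStr σ) ≡ codeStr (drop 1 σ)
drop1-codeStr []      = refl
drop1-codeStr (b ∷ σ) = codeTail-∷ b σ

hatStr : List Bool → List Bool
hatStr []      = []
hatStr (b ∷ σ) = b ∷ not b ∷ hatStr σ

hatStr-computable : Computable (λ σ → codeStr (hatStr σ))
hatStr-computable =
  StringRecursion.computable (drop 1) refl (λ _ _ → ≤-refl) codeTail tailᶜ tailᶜ-computes drop1-codeStr
    hatStr refl G gᶜ gᶜ-computes hatStr-∷
  where
  G : ℕ → ℕ → ℕ
  G y a = suc (2 * suc (2 * a + bit (not (codeHead y))) + bit (codeHead y))
  gᶜ : Code
  gᶜ = consᶜ headᶜ (consᶜ (comp notᶜ (headᶜ ∷ [])) (proj 1))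
  gᶜ-computes : Computes gᶜ (λ xs → G (nth0 0 xs) (nth0 1 xs))
  gᶜ-computes = Computes-cong
    (consᶜ-computes headᶜ-computes
      (consᶜ-computes (comp-computes notᶜ-computes (headᶜ-computes ∷ᶜ []ᶜ)) (proj-computes 1)))
    (λ xs → cong (λ h → suc (2 * suc (2 * nth0 1 xs + h) + bit (codeHead (nth0 0 xs))))
                 (bit-not (codeHead (nth0 0 xs))))
  hatStr-∷ : ∀ b σ → codeStr (hatStr (b ∷ σ)) ≡ G (codeStr (b ∷ σ)) (codeStr (hatStr σ))
  hatStr-∷ b σ rewrite codeHead-∷ b σ = refl

evens : List Bool → List Bool
evens []          = []
evens (a ∷ [])    = a ∷ []
evens (a ∷ _ ∷ τ) = a ∷ evens τ

evens-computable : Computable (λ σ → codeStr (evens σ))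
evens-computable = StringRecursion.computable (drop 2) refl drop2-shrinks (λ y → codeTail (codeTail y))
  (comp tailᶜ (tailᶜ ∷ [])) (comp-computes tailᶜ-computes (tailᶜ-computes ∷ᶜ []ᶜ)) drop2-codeStr
  evens refl G (consᶜ headᶜ (proj 1)) (consᶜ-computes headᶜ-computes (proj-computes 1)) evens-∷
  where
  drop2-shrinks : ∀ (b : Bool) σ → length (drop 1 σ) ≤ length σ
  drop2-shrinks _ []      = z≤n
  drop2-shrinks _ (_ ∷ σ) = n≤1+n (length σ)
  drop2-codeStr : ∀ σ → codeTail (codeTail (codeStr σ)) ≡ codeStr (drop 2 σ)
  drop2-codeStr []      = refl
  drop2-codeStr (b ∷ σ) = trans (cong codeTail (codeTail-∷ b σ)) (drop1-codeStr σ)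
  G : ℕ → ℕ → ℕ
  G y a = suc (2 * a + bit (codeHead y))
  evens-∷ : ∀ b σ → codeStr (evens (b ∷ σ)) ≡ G (codeStr (b ∷ σ)) (codeStr (evens (drop 1 σ)))
  evens-∷ b []      rewrite codeHead-∷ b [] = refl
  evens-∷ b (c ∷ σ) rewrite codeHead-∷ b (c ∷ σ) = refl

_∘ᵢ_ : ℕ → Code → ℕ
e ∘ᵢ d = pair 2 (pair e (pair (encode d) 0))

φ-∘ᵢ : ∀ e d {x u y} → Eval d (x ∷ []) u → φ e ⟨ u ⟩↓ y → φ (e ∘ᵢ d) ⟨ x ⟩↓ y
φ-∘ᵢ e d ev-d (c , refl , ev-c) = comp c (d ∷ []) , refl , ev-comp (evl-∷ ev-d evl-[]) ev-c

∘ᵢᶜ : Code → Code → Code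
∘ᵢᶜ a d = pairᶜ (constᶜ 2) (pairᶜ a (pairᶜ (quoteᶜ d) zer))

∘ᵢᶜ-computes : ∀ {a A} → Computes a A → ∀ d → Computes (∘ᵢᶜ a d) (λ xs → A xs ∘ᵢ d)
∘ᵢᶜ-computes comp-A d =
  pairᶜ-computes (constᶜ-computes 2) (pairᶜ-computes comp-A (pairᶜ-computes (quoteᶜ-computes d) zer-computes))

combineᵢ : Code → Code → ℕ → ℕ
combineᵢ f g e = pair 2 (pair (encode f) (pair (encode g) (pair e 0)))

φ-combineᵢ : ∀ f g e {x u v F} → Computes f F → Eval g (x ∷ []) u → φ e ⟨ x ⟩↓ v →
             φ (combineᵢ f g e) ⟨ x ⟩↓ F (u ∷ v ∷ [])
φ-combineᵢ f g e comp-F ev-g (c , refl , ev-c) =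
  comp f (g ∷ c ∷ []) , refl , ev-comp (evl-∷ ev-g (evl-∷ ev-c evl-[])) (comp-F _)

combineᵢᶜ : Code → Code → Code → Code
combineᵢᶜ f g a = pairᶜ (constᶜ 2) (pairᶜ (quoteᶜ f) (pairᶜ (quoteᶜ g) (pairᶜ a zer)))

combineᵢᶜ-computes : ∀ f g {a A} → Computes a A →
                     Computes (combineᵢᶜ f g a) (λ xs → combineᵢ f g (A xs))
combineᵢᶜ-computes f g comp-A = pairᶜ-computes (constᶜ-computes 2)
  (pairᶜ-computes (quoteᶜ-computes f)
    (pairᶜ-computes (quoteᶜ-computes g) (pairᶜ-computes comp-A zer-computes)))

hat-parity : ∀ X n → hat X n ≡ parity n xor X ⌊ n /2⌋
hat-parity X zero          = refl
hat-parity X (suc zero)    = refl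
hat-parity X (suc (suc n)) rewrite not-involutive (parity n) = hat-parity (λ k → X (suc k)) n

hat-double : ∀ X n → hat X (n + n) ≡ X n
hat-double X zero    = refl
hat-double X (suc n) rewrite +-suc n n = hat-double (λ k → X (suc k)) n

hatIndex : ℕ → ℕ
hatIndex e = combineᵢ xorᶜ parityᶜ (e ∘ᵢ halfᶜ)

IsIndex-hat : ∀ {e X} → IsIndex e X → IsIndex (hatIndex e) (hat X)
IsIndex-hat {e} {X} ix n = subst (φ hatIndex e ⟨ n ⟩↓_) bit≡
  (φ-combineᵢ xorᶜ parityᶜ (e ∘ᵢ halfᶜ) xorᶜ-computes (parityᶜ-computes (n ∷ []))
     (φ-∘ᵢ e halfᶜ (halfᶜ-computes (n ∷ [])) (ix ⌊ n /2⌋)))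
  where
  bit≡ : bit (parity (bit (parity n) + bit (X ⌊ n /2⌋))) ≡ bit (hat X n)
  bit≡ = trans (parity-bit+bit (parity n) (X ⌊ n /2⌋)) (cong bit (sym (hat-parity X n)))

IsIndex-unhat : ∀ {e X} → IsIndex e (hat X) → IsIndex (e ∘ᵢ doubleᶜ) X
IsIndex-unhat {e} {X} ix n =
  subst (φ e ∘ᵢ doubleᶜ ⟨ n ⟩↓_) (cong bit (hat-double X n))
        (φ-∘ᵢ e doubleᶜ (doubleᶜ-computes (n ∷ [])) (ix (n + n)))

↾-cong : ∀ {Y Z} → (∀ n → Y n ≡ Z n) → ∀ n → Y ↾ n ≡ Z ↾ n
↾-cong Y≗Z zero    = refl
↾-cong Y≗Z (suc n) = cong₂ _∷_ (Y≗Z 0) (↾-cong (λ k → Y≗Z (suc k)) n)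

IsIndex-cong : ∀ {e Y Z} → (∀ n → Y n ≡ Z n) → IsIndex e Z → IsIndex e Y
IsIndex-cong {e} Y≗Z ix n = subst (λ b → φ e ⟨ n ⟩↓ bit b) (sym (Y≗Z n)) (ix n)

hatStr-↾ : ∀ X n → hatStr (X ↾ n) ≡ hat X ↾ (n + n)
hatStr-↾ X zero    = refl
hatStr-↾ X (suc n) rewrite +-suc n n = cong (λ τ → X 0 ∷ not (X 0) ∷ τ) (hatStr-↾ (λ k → X (suc k)) n)

evens-hat-↾ : ∀ X n → evens (hat X ↾ n) ≡ X ↾ ⌈ n /2⌉
evens-hat-↾ X zero          = refl
evens-hat-↾ X (suc zero)    = refl
evens-hat-↾ X (suc (suc n)) = cong (X 0 ∷_) (evens-hat-↾ (λ k → X (suc k)) n)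

record Reduction (C D : Class) : Set where
  field
    translate            : List Bool → List Bool
    translate-computable : Computable (λ σ → codeStr (translate σ))
    index                : ℕ → ℕ
    indexᶜ               : Code
    indexᶜ-computes      : Computes indexᶜ (λ xs → index (nth0 0 xs))
    window               : ℕ → ℕ
    window-unbounded     : ∀ N → Σ ℕ λ M → ∀ n → M ≤ n → N ≤ window n
    source               : ∀ Z → D Z → Σ (ℕ → Bool) λ X → C X ×
                             (∀ n → translate (Z ↾ n) ≡ X ↾ window n) ×
                             (∀ {e} → IsIndex e X → IsIndex (index e) Z)

  learner : (List Bool → ℕ) → List Bool → ℕ
  learner L σ = index (L (translate σ))

  learner-computable : ∀ {L} → Computable L → Computable (learner L)
  learner-computable {L} (c , comp-L) = comp indexᶜ (comp c (proj₁ translate-computable ∷ []) ∷ []) , λ σ →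
    ev-comp (evl-∷ (ev-comp (evl-∷ (proj₂ translate-computable σ) evl-[]) (comp-L (translate σ))) evl-[])
            (indexᶜ-computes _)

  ex : EXLearnable C → EXLearnable D
  ex (L , comp-L , learns) = learner L , learner-computable comp-L , learns′
    where
    learns′ : ∀ Z → D Z → Σ ℕ λ e → Σ ℕ λ M → (∀ n → M ≤ n → learner L (Z ↾ n) ≡ e) × IsIndex e Z
    learns′ Z DZ with source Z DZ
    ... | X , CX , translate-↾ , index-ok with learns X CX
    ... | e , N , converges , ix with window-unbounded N
    ... | M , unbounded = index e , M ,
      (λ n M≤n → cong index (trans (cong L (translate-↾ n)) (converges (window n) (unbounded n M≤n)))) ,
      index-ok ix

  bc : BCLearnable C → BCLearnable D
  bc (L , comp-L , learns) = learner L , learner-computable comp-L , learns′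
    where
    learns′ : ∀ Z → D Z → Σ ℕ λ M → ∀ n → M ≤ n → IsIndex (learner L (Z ↾ n)) Z
    learns′ Z DZ with source Z DZ
    ... | X , CX , translate-↾ , index-ok with learns X CX
    ... | N , good with window-unbounded N
    ... | M , unbounded = M , λ n M≤n →
      subst (λ τ → IsIndex (index (L τ)) Z) (sym (translate-↾ n))
            (index-ok (good (window n) (unbounded n M≤n)))

hatClass-reduction : ∀ C → Reduction C (hatClass C)
hatClass-reduction C = record
  { translate            = evens
  ; translate-computable = evens-computable
  ; index                = hatIndex
  ; indexᶜ               = combineᵢᶜ xorᶜ parityᶜ (∘ᵢᶜ (proj 0) halfᶜ)
  ; indexᶜ-computes      = combineᵢᶜ-computes xorᶜ parityᶜ (∘ᵢᶜ-computes (proj-computes 0) halfᶜ)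
  ; window               = ⌈_/2⌉
  ; window-unbounded     = λ N → N + N , λ n N+N≤n →
                             subst (_≤ ⌈ n /2⌉) (sym (n≡⌈n+n/2⌉ N)) (⌈n/2⌉-mono N+N≤n)
  ; source               = λ { Y (X , CX , Y≗X̂) → X , CX ,
                             (λ n → trans (cong evens (↾-cong Y≗X̂ n)) (evens-hat-↾ X n)) ,
                             (λ ix → IsIndex-cong Y≗X̂ (IsIndex-hat ix)) }
  }

hatClass-reduction⁻ : ∀ C → Reduction (hatClass C) C
hatClass-reduction⁻ C = record
  { translate            = hatStr
  ; translate-computable = hatStr-computable
  ; index                = _∘ᵢ doubleᶜ
  ; indexᶜ               = ∘ᵢᶜ (proj 0) doubleᶜ
  ; indexᶜ-computes      = ∘ᵢᶜ-computes (proj-computes 0) doubleᶜ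
  ; window               = λ n → n + n
  ; window-unbounded     = λ N → N , λ n N≤n → ≤-trans N≤n (m≤m+n n n)
  ; source               = λ X CX → hat X , (X , CX , λ _ → refl) , hatStr-↾ X , IsIndex-unhat
  }

lemma4p4 : (C : Class) → OfComputables C →
    (EXLearnable C ⇔ EXLearnable (hatClass C)) × (BCLearnable C ⇔ BCLearnable (hatClass C))
lemma4p4 C _ = mk⇔ (ex (hatClass-reduction C)) (ex (hatClass-reduction⁻ C)) ,
               mk⇔ (bc (hatClass-reduction C)) (bc (hatClass-reduction⁻ C))
  where open Reduction
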